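{- Let $G=(V,E)$ be a weighted multi-graph with integer edge weights in $\{1,\dots,W\}$ and capacities $\{b_v\}_{v\in V}$, let $\beta\geq 3$, $\beta^-\leq\beta-2$ be integers, and let $H$ be a $(\beta,\beta^-)$-$w$-$b$-EDCS of $G$. Then $H$ contains at most $2 \beta \cdot |M_G|$ edges, where $M_G$ is a maximum weight $b$-matching of $G$.
   Context: A weighted multi-graph $G=(V,E)$ has a multi-set of weighted edges $(u,v,k)$ with $u\neq v$ and weight $k\in\{1,\dots,W\}$. Each vertex $v$ has a positive integer capacity $b_v$, and the number of edges between any two vertices $u,v$ is at most $\min(b_u,b_v)$. A $b$-matching is a multi-set $M$ of edges with at most $b_v$ edges of $M$ incident to each $v$; $|M|$ is its number of edges. For a subgraph $H$, $\delta_H(v)$ is the multi-set of edges of $H$ incident to $v$ and $\mathbf{w}\!\deg_H(v)=\sum_{e\in\delta_H(v)}w(e)$. A subgraph $H$ is a $(\beta,\beta^-)$-$w$-$b$-EDCS of $G$ if (i) for every edge $(u,v,w_{uv})\in H$, $\frac{\mathbf{w}\!\deg_H(u)}{b_u}+\frac{\mathbf{w}\!\deg_H(v)}{b_v}\leq\beta\cdot w_{uv}$, and (ii) for every edge $(u,v,w_{uv})\in G\setminus H$, $\frac{\mathbf{w}\!\deg_H(u)}{b_u}+\frac{\mathbf{w}\!\deg_H(v)}{b_v}\geq\beta^-\cdot w_{uv}$. -}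

module Defs where

open import Data.Nat using (ℕ; _+_; _*_; _≤_; _⊓_)
open import Data.Integer as ℤ using (ℤ; +_)
open import Data.Fin using (Fin; _≟_)
open import Data.Bool using (Bool; true; false; if_then_else_; _∧_; _∨_)
open import Data.List using (List; length; lookup; map; allFin)
open import Data.Nat.ListAction using (sum)
open import Data.Product using (_×_)
open import Relation.Binary.PropositionalEquality using (_≡_; _≢_)
open import Relation.Nullary.Decidable using (⌊_⌋)

record Edge (n : ℕ) : Set where
  constructor edge
  field
    src : Fin n
    dst : Fin n
    wt  : ℕ
open Edge public

-- A multi-set of edges is a list; a sub-multi-set is selected by a mask
-- over the positions of the list.
Mask : {n : ℕ} → List (Edge n) → Set
Mask E = Fin (length E) → Bool

ΣE : {n : ℕ} (E : List (Edge n)) → (Fin (length E) → ℕ) → ℕ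
ΣE E f = sum (map f (allFin (length E)))

incident : {n : ℕ} → Edge n → Fin n → Bool
incident e v = ⌊ src e ≟ v ⌋ ∨ ⌊ dst e ≟ v ⌋

joins : {n : ℕ} → Edge n → Fin n → Fin n → Bool
joins e u v = (⌊ src e ≟ u ⌋ ∧ ⌊ dst e ≟ v ⌋) ∨ (⌊ src e ≟ v ⌋ ∧ ⌊ dst e ≟ u ⌋)

card : {n : ℕ} (E : List (Edge n)) → Mask E → ℕ
card E S = ΣE E (λ i → if S i then 1 else 0)

weight : {n : ℕ} (E : List (Edge n)) → Mask E → ℕ
weight E S = ΣE E (λ i → if S i then wt (lookup E i) else 0)

deg : {n : ℕ} (E : List (Edge n)) → Mask E → Fin n → ℕ
deg E S v = ΣE E (λ i → if S i ∧ incident (lookup E i) v then 1 else 0)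

wdeg : {n : ℕ} (E : List (Edge n)) → Mask E → Fin n → ℕ
wdeg E S v = ΣE E (λ i → if S i ∧ incident (lookup E i) v then wt (lookup E i) else 0)

mult : {n : ℕ} (E : List (Edge n)) → Fin n → Fin n → ℕ
mult E u v = ΣE E (λ i → if joins (lookup E i) u v then 1 else 0)

IsWeightedMultigraph : {n : ℕ} (W : ℕ) (b : Fin n → ℕ) (E : List (Edge n)) → Set
IsWeightedMultigraph {n} W b E =
  ((i : Fin (length E)) → (src (lookup E i) ≢ dst (lookup E i))
                          × (1 ≤ wt (lookup E i)) × (wt (lookup E i) ≤ W))
  × ((v : Fin n) → 1 ≤ b v)
  × ((u v : Fin n) → u ≢ v → mult E u v ≤ b u ⊓ b v)

IsBMatching : {n : ℕ} (b : Fin n → ℕ) (E : List (Edge n)) → Mask E → Set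
IsBMatching {n} b E M = (v : Fin n) → deg E M v ≤ b v

IsMaxWeightBMatching : {n : ℕ} (b : Fin n → ℕ) (E : List (Edge n)) → Mask E → Set
IsMaxWeightBMatching b E M =
  IsBMatching b E M × ((M' : Mask E) → IsBMatching b E M' → weight E M' ≤ weight E M)

-- (β, β⁻)-w-b-EDCS.  The conditions
--   wdeg_H(u)/b_u + wdeg_H(v)/b_v ≤ β·w   and   ≥ β⁻·w
-- are stated after multiplying through by b_u·b_v > 0.
IsEDCS : {n : ℕ} (β : ℕ) (β⁻ : ℤ) (b : Fin n → ℕ) (E : List (Edge n)) → Mask E → Set
IsEDCS β β⁻ b E H =
  ((i : Fin (length E)) → H i ≡ true →
     let e = lookup E i ; u = src e ; v = dst e in
     wdeg E H u * b v + wdeg E H v * b u ≤ β * wt e * (b u * b v))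
  × ((i : Fin (length E)) → H i ≡ false →
     let e = lookup E i ; u = src e ; v = dst e in
     β⁻ ℤ.* + (wt e * (b u * b v)) ℤ.≤ + (wdeg E H u * b v + wdeg E H v * b u))

-- Let S be the set of vertices saturated by M. Since M has maximum weight and all weights
-- are positive, every edge outside M has an endpoint in S. Condition (i) of the EDCS says
-- that every H-edge at v carries at least a 1/(β b_v) share of wdeg_H(v), so
-- deg_H(v) ≤ β b_v ≤ β deg_M(v) for v ∈ S. Charge each edge of H to its endpoints in S,
-- and each H-edge without such an endpoint (it lies in M) to itself; double counting over S
-- gives |H| ≤ Σ_{e ∈ M} ([e ∩ S = ∅] + β |e ∩ S|) ≤ 2β |M|.

module Submission where

open import Defs
open import Data.Nat using (ℕ; _≤_; _*_)
open import Data.Integer as ℤ using (ℤ; +_)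
open import Data.Fin using (Fin)
open import Data.List using (List)

open import Data.Bool using (Bool; true; false; if_then_else_; _∧_; _∨_)
open import Data.Fin using (zero; suc; _≟_; punchIn)
open import Data.Fin.Properties using (punchInᵢ≢i)
open import Data.List.Properties using (map-tabulate)
open import Data.List using (length; lookup)
import Data.List as List
import Data.Nat.ListAction as ListAction
open import Data.Nat using (zero; suc; _+_; _<_; _≡ᵇ_; _≤?_; z≤n; s≤s; >-nonZero)
open import Data.Nat.Properties
  using ( +-*-semiring; ≤-refl; ≤-trans; ≤-reflexive; +-mono-≤; +-monoʳ-≤; *-monoʳ-≤
        ; +-comm; *-comm; *-identityʳ; *-zeroʳ; +-identityʳ
        ; m≤m+n; m≤n+m; m<m+n; <⇒≱; n≤0⇒n≡0; *-cancelʳ-≤; ≰⇒>; module ≤-Reasoning)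
open import Data.Nat.Solver using (module +-*-Solver)
open import Data.Product using (_×_; _,_; proj₁; proj₂)
open import Data.Sum using (_⊎_; inj₁; inj₂; [_,_]′)
open import Data.Vec.Functional using (Vector; updateAt)
open import Data.Vec.Functional.Properties using (updateAt-updates; updateAt-minimal)
open import Function using (_∘_; id; const)
open import Relation.Nullary using (yes; no; contradiction)
open import Relation.Nullary.Decidable using (⌊_⌋; isYes≗does)
open import Relation.Binary.PropositionalEquality
  using (_≡_; _≢_; refl; sym; trans; cong; cong₂; subst; subst₂; module ≡-Reasoning)
open import Algebra.Properties.Semiring.Sum +-*-semiring
  using (sum; sum-syntax; sum-cong-≗; sum-remove; sum-replicate-zero; ∑-distrib-+; ∑-comm; *-distribˡ-sum)

open +-*-Solver using (solve; _:+_; _:*_; _:=_)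

∑-mono-≤ : ∀ {m} {f g : Vector ℕ m} → (∀ i → f i ≤ g i) → sum f ≤ sum g
∑-mono-≤ {zero}  f≤g = z≤n
∑-mono-≤ {suc m} f≤g = +-mono-≤ (f≤g zero) (∑-mono-≤ (f≤g ∘ suc))

term≤∑ : ∀ {m} (f : Vector ℕ m) i → f i ≤ sum f
term≤∑ f zero    = m≤m+n _ _
term≤∑ f (suc i) = ≤-trans (term≤∑ (f ∘ suc) i) (m≤n+m _ _)

∑-bump : ∀ {m} (f g : Vector ℕ m) i d →
         (∀ j → j ≢ i → f j ≡ g j) → f i ≡ g i + d → sum f ≡ sum g + d
∑-bump {suc m} f g i d f≗g fi≡gi+d = begin
  sum f                          ≡⟨ sum-remove f ⟩
  f i + sum (f ∘ punchIn i)      ≡⟨ cong₂ _+_ fi≡gi+d (sum-cong-≗ (λ j → f≗g _ (punchInᵢ≢i i j))) ⟩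
  g i + d + sum (g ∘ punchIn i)  ≡⟨ solve 3 (λ x y z → x :+ y :+ z := x :+ z :+ y) refl (g i) d _ ⟩
  g i + sum (g ∘ punchIn i) + d  ≡⟨ cong (_+ d) (sym (sum-remove g)) ⟩
  sum g + d                      ∎
  where open ≡-Reasoning

sum-tabulate : ∀ {m} (f : Vector ℕ m) → ListAction.sum (List.tabulate f) ≡ sum f
sum-tabulate {zero}  f = refl
sum-tabulate {suc m} f = cong (_+_ (f zero)) (sum-tabulate (f ∘ suc))

ΣE≡∑ : ∀ {n} (E : List (Edge n)) f → ΣE E f ≡ ∑[ i < length E ] f i
ΣE≡∑ E f = trans (cong ListAction.sum (map-tabulate id f)) (sum-tabulate f)

m≤o⇒m*o≤n*o⇒m≤n : ∀ m n o → m ≤ o → m * o ≤ n * o → m ≤ n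
m≤o⇒m*o≤n*o⇒m≤n m n zero    m≤0 _  rewrite n≤0⇒n≡0 m≤0 = z≤n
m≤o⇒m*o≤n*o⇒m≤n m n (suc o) _   le = *-cancelʳ-≤ m n (suc o) le

∧≡true⇒ : ∀ x y → x ∧ y ≡ true → x ≡ true × y ≡ true
∧≡true⇒ true true _ = refl , refl

𝟙 : Bool → ℕ
𝟙 x = if x then 1 else 0

𝟙-∧ : ∀ x y → 𝟙 (x ∧ y) ≡ 𝟙 x * 𝟙 y
𝟙-∧ true  y = sym (+-identityʳ (𝟙 y))
𝟙-∧ false y = refl

𝟙-∨ : ∀ x y → 𝟙 (x ∨ y) ≤ 𝟙 x + 𝟙 y
𝟙-∨ true  y = s≤s z≤n
𝟙-∨ false y = ≤-refl

𝟙*-≤ : ∀ x k → 𝟙 x * k ≤ k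
𝟙*-≤ true  k = ≤-reflexive (+-identityʳ k)
𝟙*-≤ false k = z≤n

if-then-0≡𝟙* : ∀ x k → (if x then k else 0) ≡ 𝟙 x * k
if-then-0≡𝟙* true  k = sym (+-identityʳ k)
if-then-0≡𝟙* false k = refl

𝟙*-guard : ∀ x {j k} → (x ≡ true → j ≤ k) → 𝟙 x * j ≤ 𝟙 x * k
𝟙*-guard true  j≤k = *-monoʳ-≤ 1 (j≤k refl)
𝟙*-guard false _   = z≤n

count≤-of-shares : ∀ {m} (p : Vector Bool m) (w : Vector ℕ m) K → (∀ j → 1 ≤ w j) →
  (∀ j → p j ≡ true → ∑[ k < m ] (𝟙 (p k) * w k) ≤ K * w j) →
  ∑[ j < m ] 𝟙 (p j) ≤ K
count≤-of-shares {m} p w K w≥1 share = m≤o⇒m*o≤n*o⇒m≤n N K T N≤T (begin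
  N * T                            ≡⟨ *-comm N T ⟩
  T * N                            ≡⟨ *-distribˡ-sum T (𝟙 ∘ p) ⟩
  ∑[ j < m ] (T * 𝟙 (p j))         ≤⟨ ∑-mono-≤ term≤ ⟩
  ∑[ j < m ] (K * (𝟙 (p j) * w j)) ≡⟨ *-distribˡ-sum K (λ j → 𝟙 (p j) * w j) ⟨
  K * T                            ∎)
  where
  open ≤-Reasoning
  N = ∑[ j < m ] 𝟙 (p j)
  T = ∑[ j < m ] (𝟙 (p j) * w j)
  N≤T : N ≤ T
  N≤T = ∑-mono-≤ {m} (λ j → ≤-trans (≤-reflexive (sym (*-identityʳ (𝟙 (p j))))) (*-monoʳ-≤ (𝟙 (p j)) (w≥1 j)))
  term≤ : ∀ j → T * 𝟙 (p j) ≤ K * (𝟙 (p j) * w j)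
  term≤ j = begin
    T * 𝟙 (p j)         ≡⟨ *-comm T _ ⟩
    𝟙 (p j) * T         ≤⟨ 𝟙*-guard (p j) (share j) ⟩
    𝟙 (p j) * (K * w j) ≡⟨ solve 3 (λ x y z → x :* (y :* z) := y :* (x :* z)) refl (𝟙 (p j)) K (w j) ⟩
    K * (𝟙 (p j) * w j) ∎

𝟙≡ᵇ0+β*c≤2*β : ∀ β c → 1 ≤ β → c ≤ 2 → 𝟙 (c ≡ᵇ 0) + β * c ≤ 2 * β
𝟙≡ᵇ0+β*c≤2*β β 0 β≥1 _ = ≤-trans (≤-reflexive (cong suc (*-zeroʳ β))) (≤-trans β≥1 (m≤m+n β _))
𝟙≡ᵇ0+β*c≤2*β β 1 _   _ = ≤-trans (≤-reflexive (*-identityʳ β)) (m≤m+n β _)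
𝟙≡ᵇ0+β*c≤2*β β 2 _   _ = ≤-reflexive (*-comm β 2)
𝟙≡ᵇ0+β*c≤2*β β (suc (suc (suc _))) _ (s≤s (s≤s ()))

𝟙≤𝟙*𝟙≡ᵇ0+𝟙*c : ∀ h x c → (x ≡ false → 1 ≤ c) → 𝟙 h ≤ 𝟙 x * 𝟙 (c ≡ᵇ 0) + 𝟙 h * c
𝟙≤𝟙*𝟙≡ᵇ0+𝟙*c false _     _       _     = z≤n
𝟙≤𝟙*𝟙≡ᵇ0+𝟙*c true  _     (suc c) _     = ≤-trans (s≤s z≤n) (m≤n+m _ _)
𝟙≤𝟙*𝟙≡ᵇ0+𝟙*c true  true  zero    _     = s≤s z≤n
𝟙≤𝟙*𝟙≡ᵇ0+𝟙*c true  false zero    c≥1 = contradiction (c≥1 refl) λ ()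

charging-bound : ∀ {m} (H M : Vector Bool m) (c : Vector ℕ m) β → 1 ≤ β →
  (∀ i → c i ≤ 2) → (∀ i → M i ≡ false → 1 ≤ c i) →
  ∑[ i < m ] (𝟙 (H i) * c i) ≤ β * ∑[ i < m ] (𝟙 (M i) * c i) →
  ∑[ i < m ] 𝟙 (H i) ≤ 2 * β * ∑[ i < m ] 𝟙 (M i)
charging-bound {m} H M c β β≥1 c≤2 c≥1-off-M H≤βM = begin
  ∑[ i < m ] 𝟙 (H i)
    ≤⟨ ∑-mono-≤ {m} (λ i → 𝟙≤𝟙*𝟙≡ᵇ0+𝟙*c (H i) (M i) (c i) (c≥1-off-M i)) ⟩
  ∑[ i < m ] (𝟙 (M i) * z i + 𝟙 (H i) * c i)
    ≡⟨ ∑-distrib-+ (λ i → 𝟙 (M i) * z i) (λ i → 𝟙 (H i) * c i) ⟩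
  Z + ∑[ i < m ] (𝟙 (H i) * c i)
    ≤⟨ +-monoʳ-≤ Z H≤βM ⟩
  Z + β * ∑[ i < m ] (𝟙 (M i) * c i)
    ≡⟨ cong (_+_ Z) (*-distribˡ-sum β (λ i → 𝟙 (M i) * c i)) ⟩
  Z + ∑[ i < m ] (β * (𝟙 (M i) * c i))
    ≡⟨ ∑-distrib-+ (λ i → 𝟙 (M i) * z i) (λ i → β * (𝟙 (M i) * c i)) ⟨
  ∑[ i < m ] (𝟙 (M i) * z i + β * (𝟙 (M i) * c i))
    ≡⟨ sum-cong-≗ {m} factor ⟩
  ∑[ i < m ] (𝟙 (M i) * (z i + β * c i))
    ≤⟨ ∑-mono-≤ {m} (λ i → 𝟙*-guard (M i) (λ _ → 𝟙≡ᵇ0+β*c≤2*β β (c i) β≥1 (c≤2 i))) ⟩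
  ∑[ i < m ] (𝟙 (M i) * (2 * β))
    ≡⟨ sum-cong-≗ {m} (λ i → *-comm (𝟙 (M i)) (2 * β)) ⟩
  ∑[ i < m ] (2 * β * 𝟙 (M i))
    ≡⟨ *-distribˡ-sum (2 * β) (𝟙 ∘ M) ⟨
  2 * β * ∑[ i < m ] 𝟙 (M i)
    ∎
  where
  open ≤-Reasoning
  z : Vector ℕ m
  z i = 𝟙 (c i ≡ᵇ 0)
  Z = ∑[ i < m ] (𝟙 (M i) * z i)
  factor : ∀ i → 𝟙 (M i) * z i + β * (𝟙 (M i) * c i) ≡ 𝟙 (M i) * (z i + β * c i)
  factor i = solve 4 (λ x z β c → x :* z :+ β :* (x :* c) := x :* (z :+ β :* c)) refl (𝟙 (M i)) (z i) β (c i)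

insert : ∀ {m} → Vector Bool m → Fin m → Vector Bool m
insert X i = updateAt X i (const true)

∑-insert : ∀ {m} (X : Vector Bool m) i (h : Vector ℕ m) → X i ≡ false →
  ∑[ j < m ] (𝟙 (insert X i j) * h j) ≡ ∑[ j < m ] (𝟙 (X j) * h j) + h i
∑-insert X i h Xi≡false = ∑-bump _ _ i (h i)
  (λ j j≢i → cong (λ x → 𝟙 x * h j) (updateAt-minimal j i X j≢i))
  (begin
    𝟙 (insert X i i) * h i ≡⟨ cong (λ x → 𝟙 x * h i) (updateAt-updates i X) ⟩
    h i + 0                ≡⟨ +-comm (h i) 0 ⟩
    𝟙 false * h i + h i    ≡⟨ cong (λ x → 𝟙 x * h i + h i) Xi≡false ⟨
    𝟙 (X i) * h i + h i    ∎)
  where open ≡-Reasoning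

∑-𝟙-≟ : ∀ {n} (a : Fin n) → ∑[ v < n ] 𝟙 ⌊ a ≟ v ⌋ ≡ 1
∑-𝟙-≟ {suc n} zero    = cong suc (sum-replicate-zero n)
∑-𝟙-≟ {suc n} (suc a) = trans (sum-cong-≗ {n} ⌊suc≟suc⌋) (∑-𝟙-≟ a)
  where
  ⌊suc≟suc⌋ : ∀ v → 𝟙 ⌊ suc a ≟ suc v ⌋ ≡ 𝟙 ⌊ a ≟ v ⌋
  ⌊suc≟suc⌋ v = cong 𝟙 (trans (isYes≗does (suc a ≟ suc v)) (sym (isYes≗does (a ≟ v))))

incident⇒endpoint : ∀ {n} (e : Edge n) v → incident e v ≡ true → src e ≡ v ⊎ dst e ≡ v
incident⇒endpoint e v _ with src e ≟ v | dst e ≟ v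
... | yes s≡v | _       = inj₁ s≡v
... | no _    | yes d≡v = inj₂ d≡v
incident⇒endpoint e v () | no _ | no _

endpointsIn : ∀ {n} → Vector Bool n → Edge n → ℕ
endpointsIn {n} S e = ∑[ v < n ] (𝟙 (S v) * 𝟙 (incident e v))

endpointsIn≤2 : ∀ {n} (S : Vector Bool n) e → endpointsIn S e ≤ 2
endpointsIn≤2 {n} S e = begin
  endpointsIn S e
    ≤⟨ ∑-mono-≤ {n} (λ v → ≤-trans (𝟙*-≤ (S v) _) (𝟙-∨ ⌊ src e ≟ v ⌋ _)) ⟩
  ∑[ v < n ] (𝟙 ⌊ src e ≟ v ⌋ + 𝟙 ⌊ dst e ≟ v ⌋)
    ≡⟨ ∑-distrib-+ (λ v → 𝟙 ⌊ src e ≟ v ⌋) (λ v → 𝟙 ⌊ dst e ≟ v ⌋) ⟩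
  ∑[ v < n ] 𝟙 ⌊ src e ≟ v ⌋ + ∑[ v < n ] 𝟙 ⌊ dst e ≟ v ⌋
    ≡⟨ cong₂ _+_ (∑-𝟙-≟ (src e)) (∑-𝟙-≟ (dst e)) ⟩
  2
    ∎
  where open ≤-Reasoning

endpointsIn≡0⇒∉ : ∀ {n} (S : Vector Bool n) e v → endpointsIn S e ≡ 0 → incident e v ≡ true → S v ≡ false
endpointsIn≡0⇒∉ S e v none inc with S v | term≤∑ (λ u → 𝟙 (S u) * 𝟙 (incident e u)) v
... | false | _   = refl
... | true  | Sv≤ = contradiction (subst₂ (λ x y → 𝟙 x + 0 ≤ y) inc none Sv≤) λ ()

module _ {n} (E : List (Edge n)) where

  private
    m = length E

  deg≡∑ : ∀ X v → deg E X v ≡ ∑[ j < m ] (𝟙 (X j) * 𝟙 (incident (lookup E j) v))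
  deg≡∑ X v = trans (ΣE≡∑ E _) (sum-cong-≗ {m} (λ j → 𝟙-∧ (X j) _))

  wdeg≡∑ : ∀ X v → wdeg E X v ≡ ∑[ j < m ] (𝟙 (X j ∧ incident (lookup E j) v) * wt (lookup E j))
  wdeg≡∑ X v = trans (ΣE≡∑ E _) (sum-cong-≗ {m} (λ j → if-then-0≡𝟙* (X j ∧ incident (lookup E j) v) _))

  weight≡∑ : ∀ X → weight E X ≡ ∑[ j < m ] (𝟙 (X j) * wt (lookup E j))
  weight≡∑ X = trans (ΣE≡∑ E _) (sum-cong-≗ {m} (λ j → if-then-0≡𝟙* (X j) _))

  ∑-deg≡∑-endpointsIn : ∀ (S : Vector Bool n) X →
    ∑[ v < n ] (𝟙 (S v) * deg E X v) ≡ ∑[ j < m ] (𝟙 (X j) * endpointsIn S (lookup E j))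
  ∑-deg≡∑-endpointsIn S X = begin
    ∑[ v < n ] (𝟙 (S v) * deg E X v)
      ≡⟨ sum-cong-≗ {n} (λ v → cong (𝟙 (S v) *_) (deg≡∑ X v)) ⟩
    ∑[ v < n ] (𝟙 (S v) * ∑[ j < m ] (𝟙 (X j) * ι j v))
      ≡⟨ sum-cong-≗ {n} (λ v → *-distribˡ-sum (𝟙 (S v)) (λ j → 𝟙 (X j) * ι j v)) ⟩
    ∑[ v < n ] ∑[ j < m ] (𝟙 (S v) * (𝟙 (X j) * ι j v))
      ≡⟨ ∑-comm {n} {m} _ ⟩
    ∑[ j < m ] ∑[ v < n ] (𝟙 (S v) * (𝟙 (X j) * ι j v))
      ≡⟨ sum-cong-≗ {m} (λ j → sum-cong-≗ {n} (λ v → swap (S v) (X j) (ι j v))) ⟩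
    ∑[ j < m ] ∑[ v < n ] (𝟙 (X j) * (𝟙 (S v) * ι j v))
      ≡⟨ sum-cong-≗ {m} (λ j → *-distribˡ-sum (𝟙 (X j)) (λ v → 𝟙 (S v) * ι j v)) ⟨
    ∑[ j < m ] (𝟙 (X j) * endpointsIn S (lookup E j))
      ∎
    where
    open ≡-Reasoning
    ι : Fin m → Fin n → ℕ
    ι j v = 𝟙 (incident (lookup E j) v)
    swap : ∀ s x i → 𝟙 s * (𝟙 x * i) ≡ 𝟙 x * (𝟙 s * i)
    swap s x i = solve 3 (λ a b c → a :* (b :* c) := b :* (a :* c)) refl (𝟙 s) (𝟙 x) i

  ∑-endpointsIn-≤ : ∀ (S : Vector Bool n) X Y k → (∀ v → S v ≡ true → deg E X v ≤ k * deg E Y v) →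
    ∑[ j < m ] (𝟙 (X j) * endpointsIn S (lookup E j)) ≤ k * ∑[ j < m ] (𝟙 (Y j) * endpointsIn S (lookup E j))
  ∑-endpointsIn-≤ S X Y k X≤kY = begin
    ∑[ j < m ] (𝟙 (X j) * endpointsIn S (lookup E j)) ≡⟨ ∑-deg≡∑-endpointsIn S X ⟨
    ∑[ v < n ] (𝟙 (S v) * deg E X v)                  ≤⟨ ∑-mono-≤ {n} (λ v → 𝟙*-guard (S v) (X≤kY v)) ⟩
    ∑[ v < n ] (𝟙 (S v) * (k * deg E Y v))
      ≡⟨ sum-cong-≗ {n} (λ v → solve 3 (λ s k d → s :* (k :* d) := k :* (s :* d)) refl (𝟙 (S v)) k (deg E Y v)) ⟩
    ∑[ v < n ] (k * (𝟙 (S v) * deg E Y v))            ≡⟨ *-distribˡ-sum k (λ v → 𝟙 (S v) * deg E Y v) ⟨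
    k * ∑[ v < n ] (𝟙 (S v) * deg E Y v)              ≡⟨ cong (k *_) (∑-deg≡∑-endpointsIn S Y) ⟩
    k * ∑[ j < m ] (𝟙 (Y j) * endpointsIn S (lookup E j)) ∎
    where open ≤-Reasoning

cancel-other-endpoint : ∀ {x} β s w d → 1 ≤ d → x * d ≤ β * w * (s * d) → x ≤ β * s * w
cancel-other-endpoint {x} β s w d d≥1 le = *-cancelʳ-≤ x (β * s * w) d {{>-nonZero d≥1}}
  (≤-trans le (≤-reflexive (solve 4 (λ β w s d → β :* w :* (s :* d) := β :* s :* w :* d) refl β w s d)))

module _ {n} (b : Fin n → ℕ) (E : List (Edge n)) where

  private
    m = length E

  HasBoundedEdgeDegrees : ℕ → Mask E → Set
  HasBoundedEdgeDegrees β H = (i : Fin m) → H i ≡ true →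
    let e = lookup E i ; u = src e ; v = dst e in
    wdeg E H u * b v + wdeg E H v * b u ≤ β * wt e * (b u * b v)

  module _ (b≥1 : ∀ v → 1 ≤ b v) (β : ℕ) (H : Mask E) (bounded : HasBoundedEdgeDegrees β H) where

    wdeg≤-at-endpoint : ∀ j v → H j ∧ incident (lookup E j) v ≡ true → wdeg E H v ≤ β * b v * wt (lookup E j)
    wdeg≤-at-endpoint j v Hj∧inc with ∧≡true⇒ (H j) _ Hj∧inc
    ... | Hj , inc = [ (λ s≡v → subst P s≡v wdeg-src≤) , (λ d≡v → subst P d≡v wdeg-dst≤) ]′
                       (incident⇒endpoint e v inc)
      where
      e = lookup E j
      s = src e
      d = dst e
      P : Fin n → Set
      P u = wdeg E H u ≤ β * b u * wt e
      wdeg-src≤ : P s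
      wdeg-src≤ = cancel-other-endpoint β (b s) (wt e) (b d) (b≥1 d) (≤-trans (m≤m+n _ _) (bounded j Hj))
      wdeg-dst≤ : P d
      wdeg-dst≤ = cancel-other-endpoint β (b d) (wt e) (b s) (b≥1 s) (≤-trans (m≤n+m _ _) bounded′)
        where
        bounded′ : wdeg E H s * b d + wdeg E H d * b s ≤ β * wt e * (b d * b s)
        bounded′ = ≤-trans (bounded j Hj) (≤-reflexive (cong (β * wt e *_) (*-comm (b s) (b d))))

    deg≤β*b : (∀ j → 1 ≤ wt (lookup E j)) → ∀ v → deg E H v ≤ β * b v
    deg≤β*b w≥1 v = subst (_≤ β * b v) (sym (ΣE≡∑ E _))
      (count≤-of-shares (λ j → H j ∧ incident (lookup E j) v) (wt ∘ lookup E) (β * b v) w≥1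
        (λ j Hj∧inc → subst (_≤ β * b v * wt (lookup E j)) (wdeg≡∑ E H v) (wdeg≤-at-endpoint j v Hj∧inc)))

  saturated : Mask E → Vector Bool n
  saturated M v = ⌊ b v ≤? deg E M v ⌋

  saturated⇒≤ : ∀ M v → saturated M v ≡ true → b v ≤ deg E M v
  saturated⇒≤ M v with b v ≤? deg E M v
  ... | yes b≤deg = λ _ → b≤deg
  ... | no  _     = λ ()

  unsaturated⇒> : ∀ M v → saturated M v ≡ false → deg E M v < b v
  unsaturated⇒> M v with b v ≤? deg E M v
  ... | yes _     = λ ()
  ... | no  b≰deg = λ _ → ≰⇒> b≰deg

  deg-insert : ∀ M i v → M i ≡ false → deg E (insert M i) v ≡ deg E M v + 𝟙 (incident (lookup E i) v)
  deg-insert M i v Mi≡false = trans (deg≡∑ E (insert M i) v)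
    (trans (∑-insert M i _ Mi≡false) (cong (_+ 𝟙 (incident (lookup E i) v)) (sym (deg≡∑ E M v))))

  weight-insert : ∀ M i → M i ≡ false → weight E (insert M i) ≡ weight E M + wt (lookup E i)
  weight-insert M i Mi≡false = trans (weight≡∑ E (insert M i))
    (trans (∑-insert M i _ Mi≡false) (cong (_+ wt (lookup E i)) (sym (weight≡∑ E M))))

  insert-isBMatching : ∀ M i → IsBMatching b E M → M i ≡ false →
    endpointsIn (saturated M) (lookup E i) ≡ 0 → IsBMatching b E (insert M i)
  insert-isBMatching M i bm Mi≡false none v =
    subst (_≤ b v) (sym (deg-insert M i v Mi≡false)) (room (incident (lookup E i) v) refl)
    where
    room : ∀ x → incident (lookup E i) v ≡ x → deg E M v + 𝟙 x ≤ b v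
    room false _   = ≤-trans (≤-reflexive (+-identityʳ _)) (bm v)
    room true  inc = ≤-trans (≤-reflexive (+-comm _ 1))
      (unsaturated⇒> M v (endpointsIn≡0⇒∉ (saturated M) (lookup E i) v none inc))

  maxWeight⇒saturated-endpoint : (∀ j → 1 ≤ wt (lookup E j)) → ∀ M → IsMaxWeightBMatching b E M →
    ∀ i → M i ≡ false → 1 ≤ endpointsIn (saturated M) (lookup E i)
  maxWeight⇒saturated-endpoint w≥1 M (bm , maximum) i Mi≡false with endpointsIn (saturated M) (lookup E i) in c
  ... | suc _ = s≤s z≤n
  ... | zero  = contradiction (maximum (insert M i) (insert-isBMatching M i bm Mi≡false c)) (<⇒≱ (begin-strict
    weight E M                     <⟨ m<m+n _ (w≥1 i) ⟩
    weight E M + wt (lookup E i)   ≡⟨ weight-insert M i Mi≡false ⟨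
    weight E (insert M i)          ∎))
    where open ≤-Reasoning

proposition18 : (n W : ℕ) (b : Fin n → ℕ) (E : List (Edge n)) →
    IsWeightedMultigraph W b E →
    (β : ℕ) (β⁻ : ℤ) → 3 ≤ β → β⁻ ℤ.≤ + β ℤ.- + 2 →
    (H : Mask E) → IsEDCS β β⁻ b E H →
    (M : Mask E) → IsMaxWeightBMatching b E M →
    card E H ≤ 2 * β * card E M
proposition18 n W b E (edges , b≥1 , _) β β⁻ β≥3 _ H (bounded , _) M maxM =
  subst₂ _≤_ (sym (ΣE≡∑ E _)) (cong (2 * β *_) (sym (ΣE≡∑ E _)))
    (charging-bound H M (endpointsIn S ∘ lookup E) β (≤-trans (s≤s z≤n) β≥3)
      (λ i → endpointsIn≤2 S (lookup E i))
      (maxWeight⇒saturated-endpoint b E w≥1 M maxM)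
      (∑-endpointsIn-≤ E S H M β H≤βM-on-S))
  where
  w≥1 : ∀ i → 1 ≤ wt (lookup E i)
  w≥1 i = proj₁ (proj₂ (edges i))
  S : Vector Bool n
  S = saturated b E M
  H≤βM-on-S : ∀ v → S v ≡ true → deg E H v ≤ β * deg E M v
  H≤βM-on-S v sat = ≤-trans (deg≤β*b b E b≥1 β H bounded w≥1 v) (*-monoʳ-≤ β (saturated⇒≤ b E M v sat))
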